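{- A graph $G$ has the property that $\gamma_R(H)=\frac{3}{2}\gamma_{r2}(H)$ for every induced subgraph $H$ of $G$ with $\gamma_{r2}(H)\geq 3$ if and only if $G$ is $\{\bar{K}_3, K_2\cup K_1\}$-free.
   Context: All graphs are finite, simple and undirected. A $2$-rainbow dominating function of a graph $G$ is a function $f:V(G)\to 2^{\{1,2\}}$ such that $\bigcup_{v\in N_G(u)} f(v)=\{1,2\}$ for every vertex $u$ with $f(u)=\emptyset$; its weight is $\sum_{u\in V(G)}|f(u)|$, and $\gamma_{r2}(G)$ is the minimum weight of a $2$-rainbow dominating function of $G$. A Roman dominating function of $G$ is a function $g:V(G)\to\{0,1,2\}$ such that every vertex $u$ with $g(u)=0$ has a neighbor $v$ with $g(v)=2$; its weight is $\sum_{u\in V(G)} g(u)$, and $\gamma_R(G)$ is the minimum weight of a Roman dominating function of $G$. $\bar{K}_3$ is the edgeless graph on $3$ vertices and $K_2\cup K_1$ is the disjoint union of an edge and an isolated vertex; $G$ is $\{\bar{K}_3, K_2\cup K_1\}$-free if it has no induced subgraph isomorphic to either of these graphs. -}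

module Defs where

open import Data.Nat using (ℕ; zero; suc; _+_; _*_; _≤_)
open import Data.Bool using (Bool; true; false)
open import Data.Fin using (Fin; zero; suc; toℕ)
open import Data.Fin.Subset using (Subset; ⊥; _∈_; ∣_∣)
open import Data.Product using (Σ; ∃; _×_; _,_)
open import Relation.Binary.PropositionalEquality using (_≡_; _≢_)
open import Relation.Nullary using (¬_)
open import Function.Definitions using (Injective)

record Graph : Set where
  field
    n     : ℕ
    adj   : Fin n → Fin n → Bool
    sym   : ∀ u v → adj u v ≡ adj v u
    irref : ∀ u → adj u u ≡ false
open Graph public

sumF : ∀ {n} → (Fin n → ℕ) → ℕ
sumF {zero}  f = 0
sumF {suc n} f = f zero + sumF (λ i → f (suc i))

-- 2-rainbow dominating functions: f u ⊆ {1,2}, encoded as a Subset of Fin 2.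
IsR2DF : (G : Graph) → (Fin (n G) → Subset 2) → Set
IsR2DF G f = ∀ u → f u ≡ ⊥ → ∀ (c : Fin 2) → ∃ λ v → adj G u v ≡ true × c ∈ f v

weightR2 : (G : Graph) → (Fin (n G) → Subset 2) → ℕ
weightR2 G f = sumF (λ u → ∣ f u ∣)

IsGammaR2 : Graph → ℕ → Set
IsGammaR2 G k =
  (Σ (Fin (n G) → Subset 2) λ f → IsR2DF G f × weightR2 G f ≡ k) ×
  (∀ f → IsR2DF G f → k ≤ weightR2 G f)

-- Roman dominating functions: g : V → {0,1,2}, encoded as Fin 3.
IsRDF : (G : Graph) → (Fin (n G) → Fin 3) → Set
IsRDF G g = ∀ u → g u ≡ zero → ∃ λ v → adj G u v ≡ true × g v ≡ suc (suc zero)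

weightR : (G : Graph) → (Fin (n G) → Fin 3) → ℕ
weightR G g = sumF (λ u → toℕ (g u))

IsGammaR : Graph → ℕ → Set
IsGammaR G k =
  (Σ (Fin (n G) → Fin 3) λ g → IsRDF G g × weightR G g ≡ k) ×
  (∀ g → IsRDF G g → k ≤ weightR G g)

-- Induced subgraph of G on the image of an injective map ι : Fin m → V(G)
-- (every induced subgraph is isomorphic to one of these).
induced : (G : Graph) → (m : ℕ) → (ι : Fin m → Fin (n G)) → Graph
induced G m ι = record
  { n = m
  ; adj = λ i j → adj G (ι i) (ι j)
  ; sym = λ i j → sym G (ι i) (ι j)
  ; irref = λ i → irref G (ι i)
  }

HasInduced : Graph → Graph → Set
HasInduced G H = Σ (Fin (n H) → Fin (n G)) λ ι →
  Injective _≡_ _≡_ ι × (∀ i j → adj G (ι i) (ι j) ≡ adj H i j)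

K̄₃ : Graph
K̄₃ = record { n = 3 ; adj = λ _ _ → false ; sym = λ _ _ → _≡_.refl ; irref = λ _ → _≡_.refl }

K₂∪K₁-adj : Fin 3 → Fin 3 → Bool
K₂∪K₁-adj zero (suc zero) = true
K₂∪K₁-adj (suc zero) zero = true
K₂∪K₁-adj _ _ = false

K₂∪K₁ : Graph
K₂∪K₁ = record { n = 3 ; adj = K₂∪K₁-adj ; sym = s ; irref = r }
  where
    s : ∀ u v → K₂∪K₁-adj u v ≡ K₂∪K₁-adj v u
    s zero zero = _≡_.refl
    s zero (suc zero) = _≡_.refl
    s zero (suc (suc zero)) = _≡_.refl
    s (suc zero) zero = _≡_.refl
    s (suc zero) (suc zero) = _≡_.refl
    s (suc zero) (suc (suc zero)) = _≡_.refl
    s (suc (suc zero)) zero = _≡_.refl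
    s (suc (suc zero)) (suc zero) = _≡_.refl
    s (suc (suc zero)) (suc (suc zero)) = _≡_.refl
    r : ∀ u → K₂∪K₁-adj u u ≡ false
    r zero = _≡_.refl
    r (suc zero) = _≡_.refl
    r (suc (suc zero)) = _≡_.refl

K̄₃-K₂∪K₁-free : Graph → Set
K̄₃-K₂∪K₁-free G = ¬ HasInduced G K̄₃ × ¬ HasInduced G K₂∪K₁

-- K̄₃ and K₂ ∪ K₁ both have γ_R = γ_r2 = 3, so a graph containing either of them
-- as an induced subgraph violates 2 γ_R = 3 γ_r2.  Conversely, in a
-- {K̄₃, K₂ ∪ K₁}-free graph every vertex outside a non-adjacent pair v, w is
-- adjacent to both v and w; colouring v with 1 and w with 2 (or a dominating
-- vertex with both colours, if there is no such pair) gives a 2-rainbow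
-- dominating function of weight at most 2.  Freeness is inherited by induced
-- subgraphs, so no induced subgraph has γ_r2 ≥ 3 and the equality holds vacuously.
module Submission where

open import Defs
open import Data.Bool using (true; false)
open import Data.Bool.Properties using (¬-not) renaming (_≟_ to _≟ᵇ_)
open import Data.Fin using (Fin; zero; suc; toℕ; _≟_)
open import Data.Fin.Properties using (any?; suc-injective)
open import Data.Fin.Subset using (Subset; ⊥; ⊤; ⁅_⁆; _∈_; ∣_∣)
open import Data.Fin.Subset.Properties using (∈⊤; ∣⊤∣≡n; p⊆q⇒∣p∣≤∣q∣)
open import Data.Nat using (ℕ; zero; suc; _+_; _*_; _≤_; z≤n; s≤s)
open import Data.Nat.Properties
  using (+-mono-≤; +-assoc; +-identityʳ; m≤m+n; m≤n+m; ≤-refl; ≤-trans; ≤-reflexive;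
         +-commutativeSemigroup)
open import Algebra.Properties.CommutativeSemigroup +-commutativeSemigroup using (interchange)
open import Data.Product using (∃; _×_; _,_)
open import Data.Sum using (_⊎_; inj₁; inj₂)
open import Data.Vec using ([]; _∷_; here; there)
open import Function using (_∘_)
open import Function.Definitions using (Injective)
open import Relation.Binary.PropositionalEquality using (_≡_; _≢_; refl; trans; cong; cong₂; subst)
import Relation.Binary.PropositionalEquality as ≡
open import Relation.Nullary using (Dec; yes; no; does; ¬?; _×-dec_; contradiction)
open import Relation.Nullary.Decidable using (dec-true; dec-false)

sumF-zero : ∀ {k} (h : Fin k → ℕ) → (∀ u → h u ≡ 0) → sumF h ≡ 0
sumF-zero {zero}  h h≡0 = refl
sumF-zero {suc k} h h≡0 rewrite h≡0 zero = sumF-zero (h ∘ suc) (h≡0 ∘ suc)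

sumF-point : ∀ {k} (v : Fin k) (h : Fin k → ℕ) → (∀ u → u ≢ v → h u ≡ 0) → sumF h ≡ h v
sumF-point zero h h≡0 =
  trans (cong (h zero +_) (sumF-zero (h ∘ suc) (λ u → h≡0 (suc u) λ ()))) (+-identityʳ (h zero))
sumF-point (suc v) h h≡0 rewrite h≡0 zero (λ ()) =
  sumF-point v (h ∘ suc) (λ u u≢v → h≡0 (suc u) (u≢v ∘ suc-injective))

sumF-+ : ∀ {k} (f g h : Fin k → ℕ) → (∀ u → f u ≡ g u + h u) → sumF f ≡ sumF g + sumF h
sumF-+ {zero}  f g h f≡g+h = refl
sumF-+ {suc k} f g h f≡g+h = begin
  f zero + sumF (f ∘ suc)
    ≡⟨ cong₂ _+_ (f≡g+h zero) (sumF-+ (f ∘ suc) (g ∘ suc) (h ∘ suc) (f≡g+h ∘ suc)) ⟩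
  (g zero + h zero) + (sumF (g ∘ suc) + sumF (h ∘ suc))
    ≡⟨ interchange (g zero) (h zero) _ _ ⟩
  sumF g + sumF h
    ∎
  where open ≡.≡-Reasoning

zero-or-positive : ∀ {k} (x : Fin (suc k)) → x ≡ zero ⊎ 1 ≤ toℕ x
zero-or-positive zero    = inj₁ refl
zero-or-positive (suc x) = inj₂ (s≤s z≤n)

⊥-or-1≤∣p∣ : ∀ {k} (p : Subset k) → p ≡ ⊥ ⊎ 1 ≤ ∣ p ∣
⊥-or-1≤∣p∣ []          = inj₁ refl
⊥-or-1≤∣p∣ (true ∷ p)  = inj₂ (s≤s z≤n)
⊥-or-1≤∣p∣ (false ∷ p) with ⊥-or-1≤∣p∣ p
... | inj₁ p≡⊥   = inj₁ (cong (false ∷_) p≡⊥)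
... | inj₂ 1≤∣p∣ = inj₂ 1≤∣p∣

full⇒k≤∣p∣ : ∀ {k} (p : Subset k) → (∀ x → x ∈ p) → k ≤ ∣ p ∣
full⇒k≤∣p∣ {k} p full = subst (_≤ ∣ p ∣) (∣⊤∣≡n k) (p⊆q⇒∣p∣≤∣q∣ {p = ⊤} λ {x} _ → full x)

module _ (H : Graph) where

  isolated⇒1≤R : ∀ {g u} → IsRDF H g → (∀ v → adj H u v ≡ false) → 1 ≤ toℕ (g u)
  isolated⇒1≤R {g} {u} rdf isolated with zero-or-positive (g u)
  ... | inj₂ 1≤gu = 1≤gu
  ... | inj₁ gu≡0 with rdf u gu≡0
  ...   | v , uv , _ = contradiction (trans (≡.sym uv) (isolated v)) λ ()

  isolated⇒1≤R2 : ∀ {f u} → IsR2DF H f → (∀ v → adj H u v ≡ false) → 1 ≤ ∣ f u ∣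
  isolated⇒1≤R2 {f} {u} r2df isolated with ⊥-or-1≤∣p∣ (f u)
  ... | inj₂ 1≤∣fu∣ = 1≤∣fu∣
  ... | inj₁ fu≡⊥ with r2df u fu≡⊥ zero
  ...   | v , uv , _ = contradiction (trans (≡.sym uv) (isolated v)) λ ()

  unique-neighbour⇒2≤R : ∀ {g u w} → IsRDF H g → (∀ v → adj H u v ≡ true → v ≡ w) →
                         g u ≡ zero → 2 ≤ toℕ (g w)
  unique-neighbour⇒2≤R {u = u} rdf u→w gu≡0 with rdf u gu≡0
  ... | v , uv , gv≡2 rewrite u→w v uv | gv≡2 = s≤s (s≤s z≤n)

  unique-neighbour⇒2≤R2 : ∀ {f u w} → IsR2DF H f → (∀ v → adj H u v ≡ true → v ≡ w) →
                          f u ≡ ⊥ → 2 ≤ ∣ f w ∣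
  unique-neighbour⇒2≤R2 {f} {u} {w} r2df u→w fu≡⊥ = full⇒k≤∣p∣ (f w) colour∈fw
    where
      colour∈fw : ∀ c → c ∈ f w
      colour∈fw c with r2df u fu≡⊥ c
      ... | v , uv , c∈fv = subst (λ x → c ∈ f x) (u→w v uv) c∈fv

  isolatedEdge⇒2≤R : ∀ {g u w} → IsRDF H g → (∀ v → adj H u v ≡ true → v ≡ w) →
                     (∀ v → adj H w v ≡ true → v ≡ u) → 2 ≤ toℕ (g u) + toℕ (g w)
  isolatedEdge⇒2≤R {g} {u} {w} rdf u→w w→u with zero-or-positive (g u) | zero-or-positive (g w)
  ... | inj₁ gu≡0  | _          = ≤-trans (unique-neighbour⇒2≤R rdf u→w gu≡0) (m≤n+m _ _)
  ... | inj₂ _     | inj₁ gw≡0  = ≤-trans (unique-neighbour⇒2≤R rdf w→u gw≡0) (m≤m+n _ _)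
  ... | inj₂ 1≤gu  | inj₂ 1≤gw  = +-mono-≤ 1≤gu 1≤gw

  isolatedEdge⇒2≤R2 : ∀ {f u w} → IsR2DF H f → (∀ v → adj H u v ≡ true → v ≡ w) →
                      (∀ v → adj H w v ≡ true → v ≡ u) → 2 ≤ ∣ f u ∣ + ∣ f w ∣
  isolatedEdge⇒2≤R2 {f} {u} {w} r2df u→w w→u with ⊥-or-1≤∣p∣ (f u) | ⊥-or-1≤∣p∣ (f w)
  ... | inj₁ fu≡⊥   | _            = ≤-trans (unique-neighbour⇒2≤R2 r2df u→w fu≡⊥) (m≤n+m _ _)
  ... | inj₂ _      | inj₁ fw≡⊥    = ≤-trans (unique-neighbour⇒2≤R2 r2df w→u fw≡⊥) (m≤m+n _ _)
  ... | inj₂ 1≤∣fu∣ | inj₂ 1≤∣fw∣ = +-mono-≤ 1≤∣fu∣ 1≤∣fw∣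

K₂∪K₁-neighbour₀ : ∀ v → K₂∪K₁-adj zero v ≡ true → v ≡ suc zero
K₂∪K₁-neighbour₀ (suc zero) _ = refl

K₂∪K₁-neighbour₁ : ∀ v → K₂∪K₁-adj (suc zero) v ≡ true → v ≡ zero
K₂∪K₁-neighbour₁ zero _ = refl

module _ (G : Graph) (ι : Fin 3 → Fin (n G)) where

  private
    H : Graph
    H = induced G 3 ι

  module _ (copy : ∀ i j → adj G (ι i) (ι j) ≡ adj K̄₃ i j) where

    γR-K̄₃-copy : IsGammaR H 3
    γR-K̄₃-copy = ((λ _ → suc zero) , (λ _ ()) , refl) , λ g rdf →
      +-mono-≤ (isolated⇒1≤R H rdf (copy zero))
        (+-mono-≤ (isolated⇒1≤R H rdf (copy (suc zero)))
          (+-mono-≤ (isolated⇒1≤R H rdf (copy (suc (suc zero)))) z≤n))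

    γr2-K̄₃-copy : IsGammaR2 H 3
    γr2-K̄₃-copy = ((λ _ → ⁅ zero ⁆) , (λ _ ()) , refl) , λ f r2df →
      +-mono-≤ (isolated⇒1≤R2 H r2df (copy zero))
        (+-mono-≤ (isolated⇒1≤R2 H r2df (copy (suc zero)))
          (+-mono-≤ (isolated⇒1≤R2 H r2df (copy (suc (suc zero)))) z≤n))

  module _ (copy : ∀ i j → adj G (ι i) (ι j) ≡ K₂∪K₁-adj i j) where

    private
      0→1 : ∀ v → adj H zero v ≡ true → v ≡ suc zero
      0→1 v a = K₂∪K₁-neighbour₀ v (trans (≡.sym (copy zero v)) a)

      1→0 : ∀ v → adj H (suc zero) v ≡ true → v ≡ zero
      1→0 v a = K₂∪K₁-neighbour₁ v (trans (≡.sym (copy (suc zero) v)) a)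

      2-isolated : ∀ v → adj H (suc (suc zero)) v ≡ false
      2-isolated = copy (suc (suc zero))

    γR-K₂∪K₁-copy : IsGammaR H 3
    γR-K₂∪K₁-copy = (g , rdf , refl) , λ g′ rdf′ →
      subst (3 ≤_) (+-assoc (toℕ (g′ zero)) _ _)
        (+-mono-≤ (isolatedEdge⇒2≤R H rdf′ 0→1 1→0) (+-mono-≤ (isolated⇒1≤R H rdf′ 2-isolated) z≤n))
      where
        g : Fin 3 → Fin 3
        g zero             = suc (suc zero)
        g (suc zero)       = zero
        g (suc (suc zero)) = suc zero
        rdf : IsRDF H g
        rdf (suc zero) _ = zero , copy (suc zero) zero , refl
        rdf (suc (suc zero)) ()

    γr2-K₂∪K₁-copy : IsGammaR2 H 3
    γr2-K₂∪K₁-copy = (f , r2df , refl) , λ f′ r2df′ →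
      subst (3 ≤_) (+-assoc ∣ f′ zero ∣ _ _)
        (+-mono-≤ (isolatedEdge⇒2≤R2 H r2df′ 0→1 1→0) (+-mono-≤ (isolated⇒1≤R2 H r2df′ 2-isolated) z≤n))
      where
        f : Fin 3 → Subset 2
        f zero             = ⊤
        f (suc zero)       = ⊥
        f (suc (suc zero)) = ⁅ zero ⁆
        r2df : IsR2DF H f
        r2df (suc zero) _ c = zero , copy (suc zero) zero , ∈⊤
        r2df (suc (suc zero)) ()

triple : ∀ {A : Set} → A → A → A → Fin 3 → A
triple x y z zero             = x
triple x y z (suc zero)       = y
triple x y z (suc (suc zero)) = z

triple-injective : ∀ {A : Set} {x y z : A} → x ≢ y → x ≢ z → y ≢ z →
                   Injective _≡_ _≡_ (triple x y z)
triple-injective x≢y x≢z y≢z {zero}             {zero}             _ = refl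
triple-injective x≢y x≢z y≢z {zero}             {suc zero}         e = contradiction e x≢y
triple-injective x≢y x≢z y≢z {zero}             {suc (suc zero)}   e = contradiction e x≢z
triple-injective x≢y x≢z y≢z {suc zero}         {zero}             e = contradiction (≡.sym e) x≢y
triple-injective x≢y x≢z y≢z {suc zero}         {suc zero}         _ = refl
triple-injective x≢y x≢z y≢z {suc zero}         {suc (suc zero)}   e = contradiction e y≢z
triple-injective x≢y x≢z y≢z {suc (suc zero)}   {zero}             e = contradiction (≡.sym e) x≢z
triple-injective x≢y x≢z y≢z {suc (suc zero)}   {suc zero}         e = contradiction (≡.sym e) y≢z
triple-injective x≢y x≢z y≢z {suc (suc zero)}   {suc (suc zero)}   _ = refl

module _ (G : Graph) {x y z : Fin (n G)} (x≢y : x ≢ y) (x≢z : x ≢ z) (y≢z : y ≢ z)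
         (x≁z : adj G x z ≡ false) (y≁z : adj G y z ≡ false) where

  induced-K̄₃ : adj G x y ≡ false → HasInduced G K̄₃
  induced-K̄₃ x≁y = triple x y z , triple-injective x≢y x≢z y≢z , copy
    where
      copy : ∀ i j → adj G (triple x y z i) (triple x y z j) ≡ false
      copy zero             zero             = irref G x
      copy zero             (suc zero)       = x≁y
      copy zero             (suc (suc zero)) = x≁z
      copy (suc zero)       zero             = trans (sym G y x) x≁y
      copy (suc zero)       (suc zero)       = irref G y
      copy (suc zero)       (suc (suc zero)) = y≁z
      copy (suc (suc zero)) zero             = trans (sym G z x) x≁z
      copy (suc (suc zero)) (suc zero)       = trans (sym G z y) y≁z
      copy (suc (suc zero)) (suc (suc zero)) = irref G z

  induced-K₂∪K₁ : adj G x y ≡ true → HasInduced G K₂∪K₁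
  induced-K₂∪K₁ x∼y = triple x y z , triple-injective x≢y x≢z y≢z , copy
    where
      copy : ∀ i j → adj G (triple x y z i) (triple x y z j) ≡ K₂∪K₁-adj i j
      copy zero             zero             = irref G x
      copy zero             (suc zero)       = x∼y
      copy zero             (suc (suc zero)) = x≁z
      copy (suc zero)       zero             = trans (sym G y x) x∼y
      copy (suc zero)       (suc zero)       = irref G y
      copy (suc zero)       (suc (suc zero)) = y≁z
      copy (suc (suc zero)) zero             = trans (sym G z x) x≁z
      copy (suc (suc zero)) (suc zero)       = trans (sym G z y) y≁z
      copy (suc (suc zero)) (suc (suc zero)) = irref G z

HasInduced-induced : (G : Graph) → ∀ {F m} {ι : Fin m → Fin (n G)} → Injective _≡_ _≡_ ι →
                     HasInduced (induced G m ι) F → HasInduced G F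
HasInduced-induced G {ι = ι} ι-inj (κ , κ-inj , copy) = ι ∘ κ , (λ e → κ-inj (ι-inj e)) , copy

induced-free : (G : Graph) → ∀ {m} {ι : Fin m → Fin (n G)} → Injective _≡_ _≡_ ι →
               K̄₃-K₂∪K₁-free G → K̄₃-K₂∪K₁-free (induced G m ι)
induced-free G {ι = ι} ι-inj (no-K̄₃ , no-K₂∪K₁) =
  no-K̄₃ ∘ HasInduced-induced G {K̄₃} {ι = ι} ι-inj ,
  no-K₂∪K₁ ∘ HasInduced-induced G {K₂∪K₁} {ι = ι} ι-inj

free⇒common-neighbour : (G : Graph) → K̄₃-K₂∪K₁-free G → ∀ {x y z} → x ≢ y → x ≢ z → y ≢ z →
                        adj G x y ≡ false → adj G x z ≡ true × adj G y z ≡ true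
free⇒common-neighbour G (no-K̄₃ , no-K₂∪K₁) {x} {y} {z} x≢y x≢z y≢z x≁y
  with adj G x z in xz | adj G y z in yz
... | true  | true  = refl , refl
... | false | false = contradiction (induced-K̄₃ G x≢y x≢z y≢z xz yz x≁y) no-K̄₃
... | true  | false = contradiction
  (induced-K₂∪K₁ G x≢z x≢y (y≢z ∘ ≡.sym) x≁y (trans (sym G z y) yz) xz) no-K₂∪K₁
... | false | true  = contradiction
  (induced-K₂∪K₁ G y≢z (x≢y ∘ ≡.sym) (x≢z ∘ ≡.sym) (trans (sym G y x) x≁y) (trans (sym G z x) xz) yz)
  no-K₂∪K₁

pairLabel : ∀ {k} → Fin k → Fin k → Fin k → Subset 2
pairLabel v w u = does (u ≟ v) ∷ does (u ≟ w) ∷ []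

∣b∷b′∷[]∣ : ∀ b b′ → ∣ b ∷ b′ ∷ [] ∣ ≡ ∣ b ∷ [] ∣ + ∣ b′ ∷ [] ∣
∣b∷b′∷[]∣ true  _ = refl
∣b∷b′∷[]∣ false _ = refl

sumF-∣u≟v∣ : ∀ {k} (v : Fin k) → sumF (λ u → ∣ does (u ≟ v) ∷ [] ∣) ≡ 1
sumF-∣u≟v∣ v = trans (sumF-point v _ off-v) at-v
  where
    off-v : ∀ u → u ≢ v → ∣ does (u ≟ v) ∷ [] ∣ ≡ 0
    off-v u u≢v rewrite dec-false (u ≟ v) u≢v = refl
    at-v : ∣ does (v ≟ v) ∷ [] ∣ ≡ 1
    at-v rewrite dec-true (v ≟ v) refl = refl

sumF-∣pairLabel∣ : ∀ {k} (v w : Fin k) → sumF (λ u → ∣ pairLabel v w u ∣) ≡ 2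
sumF-∣pairLabel∣ v w =
  trans (sumF-+ _ _ _ (λ u → ∣b∷b′∷[]∣ (does (u ≟ v)) (does (u ≟ w))))
        (cong₂ _+_ (sumF-∣u≟v∣ v) (sumF-∣u≟v∣ w))

pairLabel-IsR2DF : (G : Graph) (v w : Fin (n G)) →
                   (∀ u → u ≢ v → u ≢ w → adj G u v ≡ true × adj G u w ≡ true) →
                   IsR2DF G (pairLabel v w)
pairLabel-IsR2DF G v w dominated u fu≡⊥ c with u ≟ v | u ≟ w
pairLabel-IsR2DF G v w dominated u () c | yes _ | _
pairLabel-IsR2DF G v w dominated u () c | no _  | yes _
... | no u≢v | no u≢w with dominated u u≢v u≢w | c
...   | u∼v , _   | zero     = v , u∼v , 1∈v
  where
    1∈v : zero ∈ pairLabel v w v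
    1∈v rewrite dec-true (v ≟ v) refl = here
...   | _   , u∼w | suc zero = w , u∼w , 2∈w
  where
    2∈w : suc zero ∈ pairLabel v w w
    2∈w rewrite dec-true (w ≟ w) refl = there here

vertex? : ∀ k → Dec (Fin k)
vertex? zero    = no λ ()
vertex? (suc k) = yes zero

free⇒γr2≤2 : (G : Graph) → K̄₃-K₂∪K₁-free G → ∃ λ f → IsR2DF G f × weightR2 G f ≤ 2
free⇒γr2≤2 G free with vertex? (n G)
... | no no-vertex =
  (λ _ → ⊥) , (λ u → contradiction u no-vertex) ,
  subst (_≤ 2) (≡.sym (sumF-zero _ λ u → contradiction u no-vertex)) z≤n
... | yes v with any? (λ w → ¬? (w ≟ v) ×-dec (adj G v w ≟ᵇ false))
...   | yes (w , w≢v , v≁w) =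
  pairLabel v w , pairLabel-IsR2DF G v w dominated , ≤-reflexive (sumF-∣pairLabel∣ v w)
  where
    dominated : ∀ u → u ≢ v → u ≢ w → adj G u v ≡ true × adj G u w ≡ true
    dominated u u≢v u≢w
      with free⇒common-neighbour G free (w≢v ∘ ≡.sym) (u≢v ∘ ≡.sym) (u≢w ∘ ≡.sym) v≁w
    ... | v∼u , w∼u = trans (sym G u v) v∼u , trans (sym G u w) w∼u
...   | no no-non-neighbour =
  pairLabel v v , pairLabel-IsR2DF G v v dominated , ≤-reflexive (sumF-∣pairLabel∣ v v)
  where
    dominated : ∀ u → u ≢ v → u ≢ v → adj G u v ≡ true × adj G u v ≡ true
    dominated u u≢v _ = u∼v , u∼v
      where
        u∼v : adj G u v ≡ true
        u∼v = trans (sym G u v) (¬-not λ v≁u → no-non-neighbour (u , u≢v , v≁u))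

theorem5 : (G : Graph) →
    ((∀ (m : ℕ) (ι : Fin m → Fin (n G)) → Injective _≡_ _≡_ ι →
       ∀ (a b : ℕ) → IsGammaR (induced G m ι) a → IsGammaR2 (induced G m ι) b →
       3 ≤ b → 2 * a ≡ 3 * b)
     → K̄₃-K₂∪K₁-free G)
    × (K̄₃-K₂∪K₁-free G →
       ∀ (m : ℕ) (ι : Fin m → Fin (n G)) → Injective _≡_ _≡_ ι →
       ∀ (a b : ℕ) → IsGammaR (induced G m ι) a → IsGammaR2 (induced G m ι) b →
       3 ≤ b → 2 * a ≡ 3 * b)
theorem5 G = ratio⇒free , free⇒ratio
  where
    Ratio : Set
    Ratio = ∀ (m : ℕ) (ι : Fin m → Fin (n G)) → Injective _≡_ _≡_ ι →
            ∀ (a b : ℕ) → IsGammaR (induced G m ι) a → IsGammaR2 (induced G m ι) b →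
            3 ≤ b → 2 * a ≡ 3 * b

    6≢9 : 6 ≢ 9
    6≢9 ()

    ratio⇒free : Ratio → K̄₃-K₂∪K₁-free G
    ratio⇒free ratio =
      (λ (ι , ι-inj , copy) → 6≢9 (ratio 3 ι ι-inj 3 3 (γR-K̄₃-copy G ι copy) (γr2-K̄₃-copy G ι copy) ≤-refl)) ,
      (λ (ι , ι-inj , copy) → 6≢9 (ratio 3 ι ι-inj 3 3 (γR-K₂∪K₁-copy G ι copy) (γr2-K₂∪K₁-copy G ι copy) ≤-refl))

    free⇒ratio : K̄₃-K₂∪K₁-free G → Ratio
    free⇒ratio free m ι ι-inj _ _ _ (_ , γr2-minimal) 3≤b
      with free⇒γr2≤2 (induced G m ι) (induced-free G ι-inj free)
    ... | f , r2df , f≤2 = contradiction (≤-trans 3≤b (≤-trans (γr2-minimal f r2df) f≤2)) λ { (s≤s (s≤s ())) }
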